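{- Let $G$ be a connected graph and let $u_1,w_1,u_2,w_2$ be vertices of $G$ with $u_1w_1\in E(G)$, $u_2w_2\in E(G)$, $w_1w_2\notin E(G)$, $u_1u_2\notin E(G)$, $d(w_1)\ge d(u_2)$ and $d(w_2)\ge d(u_1)$. Let $G'=G-u_1w_1-u_2w_2+w_1w_2+u_1u_2$. (i) If $f$ is escalating, then $M_f(G')\ge M_f(G)$, and $M_f(G')>M_f(G)$ if and only if $d(w_1)>d(u_2)$ and $d(w_2)>d(u_1)$. (ii) If $f$ is de-escalating, then $M_f(G')\le M_f(G)$, and $M_f(G')<M_f(G)$ if and only if $d(w_1)>d(u_2)$ and $d(w_2)>d(u_1)$.
   Context: All graphs are finite and simple; $d(v)$ denotes the degree of vertex $v$ (in $G$). $G-xy$ and $G+xy$ denote deleting, resp. adding, the edge $xy$. For a symmetric function $f(x,y)$ defined on pairs of positive reals, the connectivity function of a graph $G$ is $M_f(G)=\sum_{uv\in E(G)} f(d(u),d(v))$, degrees being taken in the graph in question. $f$ is called escalating if $f(x_1,x_2)+f(y_1,y_2)\ge f(x_2,y_1)+f(x_1,y_2)$ for all $x_1\ge y_1>0$ and $x_2\ge y_2>0$, with strict inequality whenever $x_1>y_1$ and $x_2>y_2$; $f$ is de-escalating if instead $f(x_1,x_2)+f(y_1,y_2)\le f(x_2,y_1)+f(x_1,y_2)$ for all such values, with strict inequality whenever $x_1>y_1$ and $x_2>y_2$. -}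

module Defs where

open import Level using (Level; _⊔_) renaming (suc to lsuc)
open import Data.Nat as ℕ using (ℕ; zero; suc)
open import Data.Fin using (Fin; toℕ)
open import Data.Bool using (Bool; true; false; if_then_else_; _∧_; _∨_)
open import Data.Product using (_×_)
open import Relation.Binary.PropositionalEquality using (_≡_)
open import Relation.Nullary using (¬_; Dec; does)
open import Relation.Binary.Structures using (IsTotalOrder)
open import Algebra.Bundles using (AbelianGroup)
open import Data.Fin using (_≟_)

-- Codomain of f: a totally ordered abelian group (ℝ with + and ≤ is one).

record OrderedAbelianGroup (c ℓ₁ ℓ₂ : Level) : Set (lsuc (c ⊔ ℓ₁ ⊔ ℓ₂)) where
  field
    abelianGroup : AbelianGroup c ℓ₁
  open AbelianGroup abelianGroup public
  field
    _≤_         : Carrier → Carrier → Set ℓ₂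
    isTotalOrder : IsTotalOrder _≈_ _≤_
    ≤-compat     : ∀ {x y} z → x ≤ y → (x ∙ z) ≤ (y ∙ z)

  _<_ : Carrier → Carrier → Set (ℓ₁ ⊔ ℓ₂)
  x < y = (x ≤ y) × ¬ (x ≈ y)

record Graph (n : ℕ) : Set where
  field
    adj   : Fin n → Fin n → Bool
    sym   : ∀ i j → adj i j ≡ adj j i
    irrefl : ∀ i → adj i i ≡ false

Edge : ∀ {n} → Graph n → Fin n → Fin n → Set
Edge G i j = Graph.adj G i j ≡ true

sumℕ : ∀ {n} → (Fin n → ℕ) → ℕ
sumℕ {zero}  g = 0
sumℕ {suc n} g = g Fin.zero ℕ.+ sumℕ (λ i → g (Fin.suc i))
  where import Data.Fin as Fin

Adj : ℕ → Set
Adj n = Fin n → Fin n → Bool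

deg : ∀ {n} → Adj n → Fin n → ℕ
deg A i = sumℕ (λ j → if A i j then 1 else 0)

data Reach {n} (G : Graph n) : Fin n → Fin n → Set where
  here : ∀ {i} → Reach G i i
  step : ∀ {i j k} → Edge G i j → Reach G j k → Reach G i k

Connected : ∀ {n} → Graph n → Set
Connected {n} G = ∀ (i j : Fin n) → Reach G i j

-- Connectivity function M_f(G) = Σ_{uv ∈ E(G)} f(d(u), d(v)),
-- each edge counted once as the pair (i , j) with toℕ i < toℕ j.

module _ {c ℓ₁ ℓ₂} (R : OrderedAbelianGroup c ℓ₁ ℓ₂) where
  open OrderedAbelianGroup R

  sumR : ∀ {n} → (Fin n → Carrier) → Carrier
  sumR {zero}  g = ε
  sumR {suc n} g = g Fin.zero ∙ sumR (λ i → g (Fin.suc i))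
    where import Data.Fin as Fin

  M : ∀ {n} → (ℕ → ℕ → Carrier) → Adj n → Carrier
  M f A = sumR (λ i → sumR (λ j →
            if does (toℕ i ℕ.<? toℕ j) ∧ A i j
            then f (deg A i) (deg A j) else ε))

  Symmetric : (ℕ → ℕ → Carrier) → Set ℓ₁
  Symmetric f = ∀ x y → f x y ≈ f y x

  Escalating : (ℕ → ℕ → Carrier) → Set (ℓ₁ ⊔ ℓ₂)
  Escalating f = ∀ x₁ x₂ y₁ y₂ → 0 ℕ.< y₁ → 0 ℕ.< y₂ → y₁ ℕ.≤ x₁ → y₂ ℕ.≤ x₂ →
    ((f x₂ y₁ ∙ f x₁ y₂) ≤ (f x₁ x₂ ∙ f y₁ y₂))
    × (y₁ ℕ.< x₁ → y₂ ℕ.< x₂ → (f x₂ y₁ ∙ f x₁ y₂) < (f x₁ x₂ ∙ f y₁ y₂))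

  DeEscalating : (ℕ → ℕ → Carrier) → Set (ℓ₁ ⊔ ℓ₂)
  DeEscalating f = ∀ x₁ x₂ y₁ y₂ → 0 ℕ.< y₁ → 0 ℕ.< y₂ → y₁ ℕ.≤ x₁ → y₂ ℕ.≤ x₂ →
    ((f x₁ x₂ ∙ f y₁ y₂) ≤ (f x₂ y₁ ∙ f x₁ y₂))
    × (y₁ ℕ.< x₁ → y₂ ℕ.< x₂ → (f x₁ x₂ ∙ f y₁ y₂) < (f x₂ y₁ ∙ f x₁ y₂))

samePair : ∀ {n} → Fin n → Fin n → Fin n → Fin n → Bool
samePair x y a b = (does (x ≟ a) ∧ does (y ≟ b)) ∨ (does (x ≟ b) ∧ does (y ≟ a))

switchAdj : ∀ {n} → Graph n → (u₁ w₁ u₂ w₂ : Fin n) → Adj n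
switchAdj G u₁ w₁ u₂ w₂ x y =
  if samePair x y w₁ w₂ ∨ samePair x y u₁ u₂ then true
  else if samePair x y u₁ w₁ ∨ samePair x y u₂ w₂ then false
  else Graph.adj G x y

-- The switch keeps every degree, so the multiset of edge weights changes only in the four
-- switched edges: M_f(G') ∙ f(u₁,w₁) ∙ f(u₂,w₂) = M_f(G) ∙ f(w₁,w₂) ∙ f(u₁,u₂).  With
-- x₁ = d(w₁), x₂ = d(w₂), y₁ = d(u₂), y₂ = d(u₁) the two brackets are exactly the two sides
-- of the (de-)escalating inequality, and cancelling in the ordered group transfers it to M_f.
-- If one of the degree inequalities is an equality, the two brackets agree by symmetry of f.
module Submission where

open import Defs
open import Level using (Level)
open import Data.Nat using (ℕ; _≥_; _>_)
open import Data.Fin using (Fin)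
open import Data.Product using (_×_)
open import Relation.Nullary using (¬_)
open import Relation.Binary.PropositionalEquality using (_≡_)
open import Function.Bundles using (_⇔_)

open import Algebra.Bundles using (CommutativeMonoid)
open import Data.Bool using (Bool; true; false; T; if_then_else_; _∧_; _∨_)
open import Data.Bool.Properties using (T-∨; T-≡)
open import Data.Empty using (⊥-elim)
open import Data.Fin using (zero; suc; toℕ; _≟_; punchIn)
open import Data.Fin.Properties using (punchInᵢ≢i; toℕ-injective)
import Data.Nat as ℕ
import Data.Nat.Properties as ℕ
open import Data.Product using (_,_; proj₁; proj₂)
open import Data.Sum using (_⊎_; inj₁; inj₂)
import Data.Sum as Sum
open import Function.Base using (_∘_)
open import Function.Bundles using (mk⇔; Equivalence)
open import Relation.Nullary using (does; yes; no)
open import Relation.Binary.Definitions using (tri<; tri≈; tri>)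
open import Relation.Binary.Structures using (IsTotalOrder)
open import Relation.Nullary.Decidable using (dec-true; dec-false)
open import Relation.Binary.PropositionalEquality as ≡ using (_≢_)

Exclusive : Bool → Bool → Set
Exclusive p q = T p → ¬ T q

∨-exclusive : ∀ {p q r s} → Exclusive p r → Exclusive p s → Exclusive q r → Exclusive q s →
  Exclusive (p ∨ q) (r ∨ s)
∨-exclusive pr ps qr qs t t′ with Equivalence.to T-∨ t | Equivalence.to T-∨ t′
... | inj₁ p | inj₁ r = pr p r
... | inj₁ p | inj₂ s = ps p s
... | inj₂ q | inj₁ r = qr q r
... | inj₂ q | inj₂ s = qs q s

switched : (added removed old : Bool) → Bool
switched added removed old = if added then true else if removed then false else old

≟-both : ∀ {n} {x y c d : Fin n} → T (does (x ≟ c) ∧ does (y ≟ d)) → x ≡ c × y ≡ d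
≟-both {x = x} {y} {c} {d} t with x ≟ c | y ≟ d
... | yes x≡c | yes y≡d = x≡c , y≡d
... | yes _   | no  _   = ⊥-elim t
... | no  _   | _       = ⊥-elim t

module IndicatorSum {c ℓ} (CM : CommutativeMonoid c ℓ) where
  open CommutativeMonoid CM
  open import Algebra.Properties.CommutativeMonoid.Sum CM public
  open import Relation.Binary.Reasoning.Setoid setoid

  _when_ : Carrier → Bool → Carrier
  x when b = if b then x else ε

  ∑∑ : ∀ {n} → (Fin n → Fin n → Carrier) → Carrier
  ∑∑ g = sum (λ i → sum (g i))

  when-cong : ∀ {x y} b → x ≈ y → x when b ≈ y when b
  when-cong true  x≈y = x≈y
  when-cong false _   = refl

  when-∧ : ∀ x p q → x when (p ∧ q) ≡ (x when p) when q
  when-∧ x true  q     = ≡.refl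
  when-∧ x false true  = ≡.refl
  when-∧ x false false = ≡.refl

  when-∨ : ∀ x {p q} → Exclusive p q → x when (p ∨ q) ≈ x when p ∙ x when q
  when-∨ x {true}  {true}  p⊥q = ⊥-elim (p⊥q _ _)
  when-∨ x {true}  {false} _   = sym (identityʳ x)
  when-∨ x {false} {q}     _   = sym (identityˡ (x when q))

  when-switched : ∀ x {added removed old} → Exclusive added removed →
    (T added → ¬ T old) → (T removed → T old) →
    x when switched added removed old ∙ x when removed ≈ x when old ∙ x when added
  when-switched x {true}  {true}          a⊥r _    _   = ⊥-elim (a⊥r _ _)
  when-switched x {true}  {false} {true}  _   a⇒¬o _   = ⊥-elim (a⇒¬o _ _)
  when-switched x {true}  {false} {false} _   _    _   = comm x ε
  when-switched x {false} {true}  {false} _   _    r⇒o = ⊥-elim (r⇒o _)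
  when-switched x {false} {true}  {true}  _   _    _   = comm ε x
  when-switched x {false} {false}         _   _    _   = refl

  ∑-distrib-∙₃ : ∀ {n} (f g h : Fin n → Carrier) →
    sum (λ i → f i ∙ (g i ∙ h i)) ≈ sum f ∙ (sum g ∙ sum h)
  ∑-distrib-∙₃ f g h = trans (∑-distrib-+ f (λ i → g i ∙ h i)) (∙-congˡ (∑-distrib-+ g h))

  ∑∑-distrib-∙₃ : ∀ {n} (f g h : Fin n → Fin n → Carrier) →
    ∑∑ (λ i j → f i j ∙ (g i j ∙ h i j)) ≈ ∑∑ f ∙ (∑∑ g ∙ ∑∑ h)
  ∑∑-distrib-∙₃ f g h = trans (sum-cong-≋ (λ i → ∑-distrib-∙₃ (f i) (g i) (h i)))
                              (∑-distrib-∙₃ (λ i → sum (f i)) (λ i → sum (g i)) (λ i → sum (h i)))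

  ∑-single : ∀ {n} (g : Fin n → Carrier) a → (∀ i → i ≢ a → g i ≈ ε) → sum g ≈ g a
  ∑-single {ℕ.suc n} g a vanish = begin
    sum g                             ≈⟨ sum-remove {i = a} g ⟩
    g a ∙ sum (g ∘ punchIn a)         ≈⟨ ∙-congˡ (sum-cong-≋ (λ i → vanish _ (punchInᵢ≢i a i))) ⟩
    g a ∙ sum {n} (λ _ → ε)           ≈⟨ ∙-congˡ (sum-replicate-zero n) ⟩
    g a ∙ ε                           ≈⟨ identityʳ (g a) ⟩
    g a                               ∎

  ∑-δ : ∀ {n} (g : Fin n → Carrier) a → sum (λ i → g i when does (i ≟ a)) ≈ g a
  ∑-δ g a = trans (∑-single _ a vanish) (reflexive (≡.cong (g a when_) (dec-true (a ≟ a) ≡.refl)))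
    where
    vanish : ∀ i → i ≢ a → g i when does (i ≟ a) ≈ ε
    vanish i i≢a = reflexive (≡.cong (g i when_) (dec-false (i ≟ a) i≢a))

  ∑-samePair : ∀ {n} (h : Fin n → Carrier) v {a b : Fin n} → a ≢ b →
    sum (λ j → h j when samePair v j a b) ≈ h b when does (v ≟ a) ∙ h a when does (v ≟ b)
  ∑-samePair h v {a} {b} a≢b = begin
    sum (λ j → h j when samePair v j a b)
      ≈⟨ sum-cong-≋ (λ j → when-∨ (h j) (exclusive j)) ⟩
    sum (λ j → h j when (v≟a ∧ does (j ≟ b)) ∙ h j when (v≟b ∧ does (j ≟ a)))
      ≈⟨ ∑-distrib-+ (λ j → h j when (v≟a ∧ does (j ≟ b))) (λ j → h j when (v≟b ∧ does (j ≟ a))) ⟩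
    sum (λ j → h j when (v≟a ∧ does (j ≟ b))) ∙ sum (λ j → h j when (v≟b ∧ does (j ≟ a)))
      ≡⟨ ≡.cong₂ _∙_ (sum-cong-≗ (λ j → when-∧ (h j) v≟a (does (j ≟ b))))
                     (sum-cong-≗ (λ j → when-∧ (h j) v≟b (does (j ≟ a)))) ⟩
    sum (λ j → (h j when v≟a) when does (j ≟ b)) ∙ sum (λ j → (h j when v≟b) when does (j ≟ a))
      ≈⟨ ∙-cong (∑-δ (λ j → h j when v≟a) b) (∑-δ (λ j → h j when v≟b) a) ⟩
    h b when v≟a ∙ h a when v≟b ∎
    where
    v≟a v≟b : Bool
    v≟a = does (v ≟ a)
    v≟b = does (v ≟ b)

    exclusive : ∀ j → Exclusive (v≟a ∧ does (j ≟ b)) (v≟b ∧ does (j ≟ a))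
    exclusive j s t =
      a≢b (≡.trans (≡.sym (proj₁ (≟-both {x = v} {j} s))) (proj₁ (≟-both {x = v} {j} t)))

  ∑∑-samePair : ∀ {n} (h : Fin n → Fin n → Carrier) {a b : Fin n} → a ≢ b →
    ∑∑ (λ i j → h i j when samePair i j a b) ≈ h a b ∙ h b a
  ∑∑-samePair h {a} {b} a≢b = begin
    ∑∑ (λ i j → h i j when samePair i j a b)
      ≈⟨ sum-cong-≋ (λ i → ∑-samePair (h i) i a≢b) ⟩
    sum (λ i → h i b when does (i ≟ a) ∙ h i a when does (i ≟ b))
      ≈⟨ ∑-distrib-+ (λ i → h i b when does (i ≟ a)) (λ i → h i a when does (i ≟ b)) ⟩
    sum (λ i → h i b when does (i ≟ a)) ∙ sum (λ i → h i a when does (i ≟ b))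
      ≈⟨ ∙-cong (∑-δ (λ i → h i b) a) (∑-δ (λ i → h i a) b) ⟩
    h a b ∙ h b a ∎

module OrderedBalance {c ℓ₁ ℓ₂} (R : OrderedAbelianGroup c ℓ₁ ℓ₂) where
  open OrderedAbelianGroup R
  open import Algebra.Properties.Group group using (∙-cancelˡ; ∙-cancelʳ; //-rightDividesʳ)
  open IsTotalOrder isTotalOrder using (≤-respˡ-≈; ≤-respʳ-≈)

  ≤-cancelʳ : ∀ {x y} z → (x ∙ z) ≤ (y ∙ z) → x ≤ y
  ≤-cancelʳ z le =
    ≤-respˡ-≈ (//-rightDividesʳ z _) (≤-respʳ-≈ (//-rightDividesʳ z _) (≤-compat (z ⁻¹) le))

  ≤-compatˡ : ∀ {x y} z → x ≤ y → (z ∙ x) ≤ (z ∙ y)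
  ≤-compatˡ z le = ≤-respˡ-≈ (comm _ z) (≤-respʳ-≈ (comm _ z) (≤-compat z le))

  module _ {a b x y} (balance : a ∙ x ≈ b ∙ y) where

    balance-≤ : x ≤ y → b ≤ a
    balance-≤ x≤y = ≤-cancelʳ x (≤-respʳ-≈ (sym balance) (≤-compatˡ b x≤y))

    balance-≈ : x ≈ y → a ≈ b
    balance-≈ x≈y = ∙-cancelʳ x a b (trans balance (∙-congˡ (sym x≈y)))

    balance-≉ : ¬ x ≈ y → ¬ b ≈ a
    balance-≉ x≉y b≈a = x≉y (∙-cancelˡ b x y (trans (∙-congʳ b≈a) balance))

    balance-order : ∀ {p} {P : Set p} → x ≤ y → (P → ¬ x ≈ y) → P ⊎ x ≈ y →
      (b ≤ a) × ((b < a) ⇔ P)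
    balance-order x≤y P⇒x≉y cases = balance-≤ x≤y , mk⇔
      (λ (_ , b≉a) → Sum.fromInj₁ (λ x≈y → ⊥-elim (b≉a (sym (balance-≈ x≈y)))) cases)
      (λ p → balance-≤ x≤y , balance-≉ (P⇒x≉y p))

module Exchange {c ℓ₁ ℓ₂} (R : OrderedAbelianGroup c ℓ₁ ℓ₂)
  (f : ℕ → ℕ → OrderedAbelianGroup.Carrier R) (f-sym : Symmetric R f) where
  open OrderedAbelianGroup R
  open OrderedBalance R

  exchange-≈ : ∀ {x₁ x₂ y₁ y₂} → x₁ ≡ y₁ ⊎ x₂ ≡ y₂ → f x₂ y₁ ∙ f x₁ y₂ ≈ f x₁ x₂ ∙ f y₁ y₂
  exchange-≈ (inj₁ ≡.refl) = ∙-congʳ (f-sym _ _)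
  exchange-≈ (inj₂ ≡.refl) = trans (comm _ _) (∙-congˡ (f-sym _ _))

  exchange-cases : ∀ {x₁ x₂ y₁ y₂} → y₁ ℕ.≤ x₁ → y₂ ℕ.≤ x₂ →
    (y₁ ℕ.< x₁ × y₂ ℕ.< x₂) ⊎ (f x₂ y₁ ∙ f x₁ y₂ ≈ f x₁ x₂ ∙ f y₁ y₂)
  exchange-cases y₁≤x₁ y₂≤x₂ with ℕ.m≤n⇒m<n∨m≡n y₁≤x₁ | ℕ.m≤n⇒m<n∨m≡n y₂≤x₂
  ... | inj₁ y₁<x₁ | inj₁ y₂<x₂ = inj₁ (y₁<x₁ , y₂<x₂)
  ... | inj₂ y₁≡x₁ | _          = inj₂ (exchange-≈ (inj₁ (≡.sym y₁≡x₁)))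
  ... | inj₁ _     | inj₂ y₂≡x₂ = inj₂ (exchange-≈ (inj₂ (≡.sym y₂≡x₂)))

  module _ {x₁ x₂ y₁ y₂ a b}
    (0<y₁ : 0 ℕ.< y₁) (0<y₂ : 0 ℕ.< y₂) (y₁≤x₁ : y₁ ℕ.≤ x₁) (y₂≤x₂ : y₂ ℕ.≤ x₂)
    (balance : a ∙ (f x₂ y₁ ∙ f x₁ y₂) ≈ b ∙ (f x₁ x₂ ∙ f y₁ y₂)) where

    escalating-balance : Escalating R f → (b ≤ a) × ((b < a) ⇔ (y₁ ℕ.< x₁ × y₂ ℕ.< x₂))
    escalating-balance esc =
      let (X≤Y , X<Y) = esc x₁ x₂ y₁ y₂ 0<y₁ 0<y₂ y₁≤x₁ y₂≤x₂
      in balance-order balance X≤Y (λ (y₁<x₁ , y₂<x₂) → proj₂ (X<Y y₁<x₁ y₂<x₂))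
           (exchange-cases y₁≤x₁ y₂≤x₂)

    de-escalating-balance : DeEscalating R f → (a ≤ b) × ((a < b) ⇔ (y₁ ℕ.< x₁ × y₂ ℕ.< x₂))
    de-escalating-balance desc =
      let (Y≤X , Y<X) = desc x₁ x₂ y₁ y₂ 0<y₁ 0<y₂ y₁≤x₁ y₂≤x₂
      in balance-order (sym balance) Y≤X (λ (y₁<x₁ , y₂<x₂) → proj₂ (Y<X y₁<x₁ y₂<x₂))
           (Sum.map₂ sym (exchange-cases y₁≤x₁ y₂≤x₂))

SameEnds : ∀ {n} (x y a b : Fin n) → Set
SameEnds x y a b = (x ≡ a × y ≡ b) ⊎ (x ≡ b × y ≡ a)

fst∉⇒¬SameEnds : ∀ {n} {x y a b : Fin n} → x ≢ a → x ≢ b → ¬ SameEnds x y a b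
fst∉⇒¬SameEnds x≢a _ (inj₁ (x≡a , _)) = x≢a x≡a
fst∉⇒¬SameEnds _ x≢b (inj₂ (x≡b , _)) = x≢b x≡b

snd∉⇒¬SameEnds : ∀ {n} {x y a b : Fin n} → y ≢ a → y ≢ b → ¬ SameEnds x y a b
snd∉⇒¬SameEnds _ y≢b (inj₁ (_ , y≡b)) = y≢b y≡b
snd∉⇒¬SameEnds y≢a _ (inj₂ (_ , y≡a)) = y≢a y≡a

samePair-sound : ∀ {n} {x y a b : Fin n} → T (samePair x y a b) → SameEnds x y a b
samePair-sound {x = x} {y} {a} {b} t = Sum.map ≟-both (≟-both {x = x} {y}) (Equivalence.to T-∨ t)

samePair-unique : ∀ {n} {x y a b c d : Fin n} →
  T (samePair x y a b) → T (samePair x y c d) → SameEnds a b c d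
samePair-unique {x = x} {y} {a} {b} {c} {d} s t
  with samePair-sound {x = x} {y} {a} {b} s | samePair-sound {x = x} {y} {c} {d} t
... | inj₁ (≡.refl , ≡.refl) | inj₁ (≡.refl , ≡.refl) = inj₁ (≡.refl , ≡.refl)
... | inj₁ (≡.refl , ≡.refl) | inj₂ (≡.refl , ≡.refl) = inj₂ (≡.refl , ≡.refl)
... | inj₂ (≡.refl , ≡.refl) | inj₁ (≡.refl , ≡.refl) = inj₂ (≡.refl , ≡.refl)
... | inj₂ (≡.refl , ≡.refl) | inj₂ (≡.refl , ≡.refl) = inj₁ (≡.refl , ≡.refl)

samePair-exclusive : ∀ {n} {x y a b c d : Fin n} → ¬ SameEnds a b c d →
  Exclusive (samePair x y a b) (samePair x y c d)
samePair-exclusive {x = x} {y} ab≠cd s t = ab≠cd (samePair-unique {x = x} {y} s t)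

samePair-adj : ∀ {n} (G : Graph n) {x y a b : Fin n} → T (samePair x y a b) →
  Graph.adj G x y ≡ Graph.adj G a b
samePair-adj G {x} {y} {a} {b} s with samePair-sound {x = x} {y} {a} {b} s
... | inj₁ (≡.refl , ≡.refl) = ≡.refl
... | inj₂ (≡.refl , ≡.refl) = Graph.sym G _ _

Edge⇒≢ : ∀ {n} (G : Graph n) {x y : Fin n} → Edge G x y → x ≢ y
Edge⇒≢ G {x} e ≡.refl with ≡.trans (≡.sym e) (Graph.irrefl G x)
... | ()

sumℕ≡sum : ∀ {n} (g : Fin n → ℕ) → sumℕ g ≡ IndicatorSum.sum ℕ.+-0-commutativeMonoid g
sumℕ≡sum {ℕ.zero}  g = ≡.refl
sumℕ≡sum {ℕ.suc n} g = ≡.cong (g zero ℕ.+_) (sumℕ≡sum (g ∘ suc))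

≤-sumℕ : ∀ {n} (g : Fin n → ℕ) a → g a ℕ.≤ sumℕ g
≤-sumℕ g zero    = ℕ.m≤m+n (g zero) _
≤-sumℕ g (suc a) = ℕ.≤-trans (≤-sumℕ (g ∘ suc) a) (ℕ.m≤n+m _ (g zero))

Edge⇒deg>0 : ∀ {n} (G : Graph n) {v w : Fin n} → Edge G v w → 0 ℕ.< deg (Graph.adj G) v
Edge⇒deg>0 G {v} {w} e = ≡.subst (ℕ._≤ deg (Graph.adj G) v)
  (≡.cong (λ b → if b then 1 else 0) e) (≤-sumℕ _ w)

sumR≡sum : ∀ {c ℓ₁ ℓ₂} (R : OrderedAbelianGroup c ℓ₁ ℓ₂) {n}
  (g : Fin n → OrderedAbelianGroup.Carrier R) →
  sumR R g ≡ IndicatorSum.sum (OrderedAbelianGroup.commutativeMonoid R) g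
sumR≡sum R {ℕ.zero}  g = ≡.refl
sumR≡sum R {ℕ.suc n} g = ≡.cong (OrderedAbelianGroup._∙_ R (g zero)) (sumR≡sum R (g ∘ suc))

module EdgeSwitch {n} (G : Graph n) (u₁ w₁ u₂ w₂ : Fin n)
  (u₁≢u₂ : u₁ ≢ u₂) (w₁≢w₂ : w₁ ≢ w₂)
  (u₁w₁ : Edge G u₁ w₁) (u₂w₂ : Edge G u₂ w₂)
  (w₁w₂∉ : ¬ Edge G w₁ w₂) (u₁u₂∉ : ¬ Edge G u₁ u₂) where

  A A' : Adj n
  A  = Graph.adj G
  A' = switchAdj G u₁ w₁ u₂ w₂

  u₁≢w₁ : u₁ ≢ w₁
  u₁≢w₁ = Edge⇒≢ G u₁w₁

  u₂≢w₂ : u₂ ≢ w₂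
  u₂≢w₂ = Edge⇒≢ G u₂w₂

  u₁≢w₂ : u₁ ≢ w₂
  u₁≢w₂ ≡.refl = u₁u₂∉ (≡.trans (Graph.sym G u₁ u₂) u₂w₂)

  u₂≢w₁ : u₂ ≢ w₁
  u₂≢w₁ ≡.refl = w₁w₂∉ u₂w₂

  -- switchAdj G u₁ w₁ u₂ w₂ x y unfolds to switched (added x y) (removed x y) (A x y).
  added removed : Fin n → Fin n → Bool
  added   x y = samePair x y w₁ w₂ ∨ samePair x y u₁ u₂
  removed x y = samePair x y u₁ w₁ ∨ samePair x y u₂ w₂

  added-exclusive : ∀ x y → Exclusive (samePair x y w₁ w₂) (samePair x y u₁ u₂)
  added-exclusive x y =
    samePair-exclusive {x = x} {y} (fst∉⇒¬SameEnds (u₁≢w₁ ∘ ≡.sym) (u₂≢w₁ ∘ ≡.sym))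

  removed-exclusive : ∀ x y → Exclusive (samePair x y u₁ w₁) (samePair x y u₂ w₂)
  removed-exclusive x y = samePair-exclusive {x = x} {y} (fst∉⇒¬SameEnds u₁≢u₂ u₁≢w₂)

  added-removed-exclusive : ∀ x y → Exclusive (added x y) (removed x y)
  added-removed-exclusive x y = ∨-exclusive
    (samePair-exclusive {x = x} {y} (snd∉⇒¬SameEnds (u₁≢w₂ ∘ ≡.sym) (w₁≢w₂ ∘ ≡.sym)))
    (samePair-exclusive {x = x} {y} (fst∉⇒¬SameEnds (u₂≢w₁ ∘ ≡.sym) w₁≢w₂))
    (samePair-exclusive {x = x} {y} (snd∉⇒¬SameEnds (u₁≢u₂ ∘ ≡.sym) u₂≢w₁))
    (samePair-exclusive {x = x} {y} (fst∉⇒¬SameEnds u₁≢u₂ u₁≢w₂))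

  added⇒¬adj : ∀ x y → T (added x y) → ¬ T (A x y)
  added⇒¬adj x y t a with Equivalence.to T-∨ t
  ... | inj₁ s = w₁w₂∉ (≡.trans (≡.sym (samePair-adj G {x} {y} s)) (Equivalence.to T-≡ a))
  ... | inj₂ s = u₁u₂∉ (≡.trans (≡.sym (samePair-adj G {x} {y} s)) (Equivalence.to T-≡ a))

  removed⇒adj : ∀ x y → T (removed x y) → T (A x y)
  removed⇒adj x y t with Equivalence.to T-∨ t
  ... | inj₁ s = Equivalence.from T-≡ (≡.trans (samePair-adj G {x} {y} s) u₁w₁)
  ... | inj₂ s = Equivalence.from T-≡ (≡.trans (samePair-adj G {x} {y} s) u₂w₂)

  module _ {c ℓ} (CM : CommutativeMonoid c ℓ) where
    open CommutativeMonoid CM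
    open IndicatorSum CM
    open import Relation.Binary.Reasoning.Setoid setoid

    when-switchAdj : ∀ x i j →
      x when A' i j ∙ (x when samePair i j u₁ w₁ ∙ x when samePair i j u₂ w₂)
        ≈ x when A i j ∙ (x when samePair i j w₁ w₂ ∙ x when samePair i j u₁ u₂)
    when-switchAdj x i j = begin
      x when A' i j ∙ (x when samePair i j u₁ w₁ ∙ x when samePair i j u₂ w₂)
        ≈⟨ ∙-congˡ (when-∨ x (removed-exclusive i j)) ⟨
      x when A' i j ∙ x when removed i j
        ≈⟨ when-switched x (added-removed-exclusive i j) (added⇒¬adj i j) (removed⇒adj i j) ⟩
      x when A i j ∙ x when added i j
        ≈⟨ ∙-congˡ (when-∨ x (added-exclusive i j)) ⟩
      x when A i j ∙ (x when samePair i j w₁ w₂ ∙ x when samePair i j u₁ u₂) ∎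

  deg-switchAdj : ∀ v → deg A' v ≡ deg A v
  deg-switchAdj v = ℕ.+-cancelʳ-≡ (r u₁ w₁ ℕ.+ r u₂ w₂) (deg A' v) (deg A v) (begin
    deg A' v ℕ.+ (r u₁ w₁ ℕ.+ r u₂ w₂)
      ≡⟨ ≡.cong (ℕ._+ (r u₁ w₁ ℕ.+ r u₂ w₂)) (sumℕ≡sum (λ j → 1 when A' v j)) ⟩
    sum (λ j → 1 when A' v j) ℕ.+ (r u₁ w₁ ℕ.+ r u₂ w₂)
      ≡⟨ ∑-distrib-∙₃ (λ j → 1 when A' v j) (λ j → 1 when samePair v j u₁ w₁)
                     (λ j → 1 when samePair v j u₂ w₂) ⟨
    sum (λ j → 1 when A' v j ℕ.+ (1 when samePair v j u₁ w₁ ℕ.+ 1 when samePair v j u₂ w₂))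
      ≡⟨ sum-cong-≗ (when-switchAdj ℕ.+-0-commutativeMonoid 1 v) ⟩
    sum (λ j → 1 when A v j ℕ.+ (1 when samePair v j w₁ w₂ ℕ.+ 1 when samePair v j u₁ u₂))
      ≡⟨ ∑-distrib-∙₃ (λ j → 1 when A v j) (λ j → 1 when samePair v j w₁ w₂)
                     (λ j → 1 when samePair v j u₁ u₂) ⟩
    sum (λ j → 1 when A v j) ℕ.+ (r w₁ w₂ ℕ.+ r u₁ u₂)
      ≡⟨ ≡.cong₂ ℕ._+_ (sumℕ≡sum (λ j → 1 when A v j)) rows ⟨
    deg A v ℕ.+ (r u₁ w₁ ℕ.+ r u₂ w₂) ∎)
    where
    open IndicatorSum ℕ.+-0-commutativeMonoid
    open ≡.≡-Reasoning
    open import Algebra.Properties.CommutativeSemigroup ℕ.+-commutativeSemigroup using (interchange)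

    r : Fin n → Fin n → ℕ
    r a b = sum (λ j → 1 when samePair v j a b)

    δ : Fin n → ℕ
    δ a = 1 when does (v ≟ a)

    rows : r u₁ w₁ ℕ.+ r u₂ w₂ ≡ r w₁ w₂ ℕ.+ r u₁ u₂
    rows = begin
      r u₁ w₁ ℕ.+ r u₂ w₂
        ≡⟨ ≡.cong₂ ℕ._+_ (∑-samePair _ v u₁≢w₁) (∑-samePair _ v u₂≢w₂) ⟩
      (δ u₁ ℕ.+ δ w₁) ℕ.+ (δ u₂ ℕ.+ δ w₂)   ≡⟨ interchange (δ u₁) (δ w₁) (δ u₂) (δ w₂) ⟩
      (δ u₁ ℕ.+ δ u₂) ℕ.+ (δ w₁ ℕ.+ δ w₂)   ≡⟨ ℕ.+-comm (δ u₁ ℕ.+ δ u₂) _ ⟩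
      (δ w₁ ℕ.+ δ w₂) ℕ.+ (δ u₁ ℕ.+ δ u₂)
        ≡⟨ ≡.cong₂ ℕ._+_ (∑-samePair _ v w₁≢w₂) (∑-samePair _ v u₁≢u₂) ⟨
      r w₁ w₂ ℕ.+ r u₁ u₂ ∎

  module Connectivity {c ℓ₁ ℓ₂} (R : OrderedAbelianGroup c ℓ₁ ℓ₂)
    (f : ℕ → ℕ → OrderedAbelianGroup.Carrier R) (f-sym : Symmetric R f) where
    open OrderedAbelianGroup R
    open IndicatorSum commutativeMonoid
    open import Relation.Binary.Reasoning.Setoid setoid

    d : Fin n → ℕ
    d = deg A

    upper : Fin n → Fin n → Carrier
    upper i j = f (d i) (d j) when does (toℕ i ℕ.<? toℕ j)

    upper-< : ∀ {i j} → toℕ i ℕ.< toℕ j → upper i j ≈ f (d i) (d j)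
    upper-< {i} {j} i<j =
      reflexive (≡.cong (f (d i) (d j) when_) (dec-true (toℕ i ℕ.<? toℕ j) i<j))

    upper-≮ : ∀ {i j} → ¬ toℕ i ℕ.< toℕ j → upper i j ≈ ε
    upper-≮ {i} {j} i≮j =
      reflexive (≡.cong (f (d i) (d j) when_) (dec-false (toℕ i ℕ.<? toℕ j) i≮j))

    upper-pair : ∀ {a b} → a ≢ b → upper a b ∙ upper b a ≈ f (d a) (d b)
    upper-pair {a} {b} a≢b with ℕ.<-cmp (toℕ a) (toℕ b)
    ... | tri< a<b _ b≮a = trans (∙-cong (upper-< a<b) (upper-≮ b≮a)) (identityʳ _)
    ... | tri≈ _ a≡b _   = ⊥-elim (a≢b (toℕ-injective a≡b))
    ... | tri> a≮b _ b<a =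
      trans (∙-cong (upper-≮ a≮b) (upper-< b<a)) (trans (identityˡ _) (f-sym _ _))

    M≡∑∑ : ∀ B → (∀ v → deg B v ≡ d v) → M R f B ≡ ∑∑ (λ i j → upper i j when B i j)
    M≡∑∑ B deg-B = ≡.trans (sumR≡sum R (λ i → sumR R (entry i)))
      (sum-cong-≗ λ i → ≡.trans (sumR≡sum R (entry i)) (sum-cong-≗ (entry≡ i)))
      where
      entry : Fin n → Fin n → Carrier
      entry i j = f (deg B i) (deg B j) when (does (toℕ i ℕ.<? toℕ j) ∧ B i j)

      entry≡ : ∀ i j → entry i j ≡ upper i j when B i j
      entry≡ i j = ≡.trans (when-∧ _ (does (toℕ i ℕ.<? toℕ j)) (B i j))
        (≡.cong (λ x → (x when does (toℕ i ℕ.<? toℕ j)) when B i j)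
                (≡.cong₂ f (deg-B i) (deg-B j)))

    ∑∑-upper-samePair : ∀ {a b} → a ≢ b →
      ∑∑ (λ i j → upper i j when samePair i j a b) ≈ f (d a) (d b)
    ∑∑-upper-samePair a≢b = trans (∑∑-samePair upper a≢b) (upper-pair a≢b)

    M-switchAdj : M R f A' ∙ (f (d w₂) (d u₂) ∙ f (d w₁) (d u₁))
                    ≈ M R f A ∙ (f (d w₁) (d w₂) ∙ f (d u₂) (d u₁))
    M-switchAdj = begin
      M R f A' ∙ (f (d w₂) (d u₂) ∙ f (d w₁) (d u₁))
        ≈⟨ ∙-cong (reflexive (M≡∑∑ A' deg-switchAdj))
                  (trans (comm _ _) (∙-cong (f-sym _ _) (f-sym _ _))) ⟩
      ∑∑ (edges A') ∙ (f (d u₁) (d w₁) ∙ f (d u₂) (d w₂))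
        ≈⟨ ∙-congˡ (∙-cong (∑∑-upper-samePair u₁≢w₁) (∑∑-upper-samePair u₂≢w₂)) ⟨
      ∑∑ (edges A') ∙ (∑∑ (pair u₁ w₁) ∙ ∑∑ (pair u₂ w₂))
        ≈⟨ ∑∑-distrib-∙₃ (edges A') (pair u₁ w₁) (pair u₂ w₂) ⟨
      ∑∑ (λ i j → edges A' i j ∙ (pair u₁ w₁ i j ∙ pair u₂ w₂ i j))
        ≈⟨ sum-cong-≋ (λ i → sum-cong-≋ (λ j → when-switchAdj commutativeMonoid (upper i j) i j)) ⟩
      ∑∑ (λ i j → edges A i j ∙ (pair w₁ w₂ i j ∙ pair u₁ u₂ i j))
        ≈⟨ ∑∑-distrib-∙₃ (edges A) (pair w₁ w₂) (pair u₁ u₂) ⟩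
      ∑∑ (edges A) ∙ (∑∑ (pair w₁ w₂) ∙ ∑∑ (pair u₁ u₂))
        ≈⟨ ∙-cong (reflexive (≡.sym (M≡∑∑ A (λ _ → ≡.refl))))
                  (∙-cong (∑∑-upper-samePair w₁≢w₂) (∑∑-upper-samePair u₁≢u₂)) ⟩
      M R f A ∙ (f (d w₁) (d w₂) ∙ f (d u₁) (d u₂))
        ≈⟨ ∙-congˡ (∙-congˡ (f-sym _ _)) ⟩
      M R f A ∙ (f (d w₁) (d w₂) ∙ f (d u₂) (d u₁)) ∎
      where
      edges : Adj n → Fin n → Fin n → Carrier
      edges B i j = upper i j when B i j

      pair : Fin n → Fin n → Fin n → Fin n → Carrier
      pair a b i j = upper i j when samePair i j a b

lemma1 : ∀ {c ℓ₁ ℓ₂ : Level} (R : OrderedAbelianGroup c ℓ₁ ℓ₂)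
  (f : ℕ → ℕ → OrderedAbelianGroup.Carrier R) → Symmetric R f →
  ∀ {n} (G : Graph n) → Connected G →
  (u₁ w₁ u₂ w₂ : Fin n) →
  ¬ (u₁ ≡ u₂) → ¬ (w₁ ≡ w₂) →
  Edge G u₁ w₁ → Edge G u₂ w₂ → ¬ Edge G w₁ w₂ → ¬ Edge G u₁ u₂ →
  deg (Graph.adj G) w₁ ≥ deg (Graph.adj G) u₂ →
  deg (Graph.adj G) w₂ ≥ deg (Graph.adj G) u₁ →
  let open OrderedAbelianGroup R
      A  = Graph.adj G
      A' = switchAdj G u₁ w₁ u₂ w₂
  in (Escalating R f →
        (M R f A ≤ M R f A')
        × ((M R f A < M R f A') ⇔ ((deg A w₁ > deg A u₂) × (deg A w₂ > deg A u₁))))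
   × (DeEscalating R f →
        (M R f A' ≤ M R f A)
        × ((M R f A' < M R f A) ⇔ ((deg A w₁ > deg A u₂) × (deg A w₂ > deg A u₁))))
lemma1 R f f-sym G _ u₁ w₁ u₂ w₂ u₁≢u₂ w₁≢w₂ u₁w₁ u₂w₂ w₁w₂∉ u₁u₂∉ du₂≤dw₁ du₁≤dw₂ =
    escalating-balance 0<du₂ 0<du₁ du₂≤dw₁ du₁≤dw₂ M-switchAdj
  , de-escalating-balance 0<du₂ 0<du₁ du₂≤dw₁ du₁≤dw₂ M-switchAdj
  where
  open EdgeSwitch G u₁ w₁ u₂ w₂ u₁≢u₂ w₁≢w₂ u₁w₁ u₂w₂ w₁w₂∉ u₁u₂∉
  open Connectivity R f f-sym
  open Exchange R f f-sym

  0<du₁ : 0 ℕ.< deg A u₁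
  0<du₁ = Edge⇒deg>0 G u₁w₁

  0<du₂ : 0 ℕ.< deg A u₂
  0<du₂ = Edge⇒deg>0 G u₂w₂
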